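{- Let $(P,\leq,\cdot)$ be a right posemigroup. For every $x,y\in P$, $(x\cdot y){\downarrow}$ is isomorphic to $(y\cdot x){\downarrow}$.
   Context: A right posemigroup is a structure $(P,\leq,\cdot)$ where $(P,\leq)$ is a poset and $\cdot$ is a right-regular band operation on $P$ (associative, with $x\cdot x=x$ and $x\cdot y\cdot x=y\cdot x$) such that for all $x,y$: $x\leq y\iff x\cdot y=x$. For $z\in P$, $z{\downarrow}=\{a\in P: a\leq z\}$; such down-sets are closed under $\cdot$, and isomorphism means a bijection preserving $\cdot$ (equivalently preserving the order). -}

module Defs where

open import Level using (Level; _⊔_; suc)
open import Data.Product using (Σ; _,_; proj₁; proj₂; _×_)
open import Relation.Binary.PropositionalEquality using (_≡_; setoid)
open import Relation.Binary.Structures using (IsPartialOrder)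

record RightPosemigroup (c ℓ : Level) : Set (Level.suc (c ⊔ ℓ)) where
  infixl 7 _·_
  infix 4 _≤_
  field
    Carrier        : Set c
    _≤_            : Carrier → Carrier → Set ℓ
    isPartialOrder : IsPartialOrder _≡_ _≤_
    _·_            : Carrier → Carrier → Carrier
    assoc          : ∀ x y z → (x · y) · z ≡ x · (y · z)
    idem           : ∀ x → x · x ≡ x
    rightRegular   : ∀ x y → x · y · x ≡ y · x
    ≤⇒·            : ∀ {x y} → x ≤ y → x · y ≡ x
    ·⇒≤            : ∀ {x y} → x · y ≡ x → x ≤ y

  ↓_ : Carrier → Set (c ⊔ ℓ)
  ↓ z = Σ Carrier (λ a → a ≤ z)

  ·↓ : ∀ {z} → ↓ z → ↓ z → ↓ z
  ·↓ {z} (a , a≤z) (b , b≤z) = a · b , ·⇒≤ closure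
    where
    open import Relation.Binary.PropositionalEquality using (trans; cong)
    closure : (a · b) · z ≡ a · b
    closure = trans (assoc a b z) (cong (a ·_) (≤⇒· b≤z))

  -- Elements of
  -- a down-set are compared by their underlying element of P (the
  -- ≤-proof component is irrelevant).
  record _≅↓_ (z w : Carrier) : Set (c ⊔ ℓ) where
    field
      to        : ↓ z → ↓ w
      to-cong   : ∀ p q → proj₁ p ≡ proj₁ q → proj₁ (to p) ≡ proj₁ (to q)
      bijective : Σ (↓ w → ↓ z) (λ from →
                    (∀ p → proj₁ (to (from p)) ≡ proj₁ p) ×
                    (∀ q → proj₁ (from (to q)) ≡ proj₁ q))
      hom       : ∀ p q → proj₁ (to (·↓ p q)) ≡ proj₁ (·↓ (to p) (to q))

{-# OPTIONS --safe #-}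
module Submission where

-- Right multiplication by u is an endomorphism of P with image in u↓,
-- because right regularity gives (a · u) · (b · u) = a · (u · b · u) = a · b · u.
-- When v · u = u and u · v = v, right multiplication by v and by u are mutually
-- inverse between u↓ and v↓, and u = x · y, v = y · x satisfy both equations.

open import Defs
open import Data.Product using (_,_; proj₁)
open import Relation.Binary.PropositionalEquality

module _ {c ℓ} (P : RightPosemigroup c ℓ) where
  open RightPosemigroup P
  open ≡-Reasoning

  ·-≤ʳ : ∀ a u → a · u ≤ u
  ·-≤ʳ a u = ·⇒≤ (begin
    a · u · u   ≡⟨ assoc a u u ⟩
    a · (u · u) ≡⟨ cong (a ·_) (idem u) ⟩
    a · u       ∎)

  ·ʳ↓ : ∀ u → Carrier → ↓ u
  ·ʳ↓ u a = a · u , ·-≤ʳ a u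

  ·-distribʳ : ∀ u a b → (a · b) · u ≡ (a · u) · (b · u)
  ·-distribʳ u a b = sym (begin
    (a · u) · (b · u) ≡⟨ assoc a u (b · u) ⟩
    a · (u · (b · u)) ≡⟨ cong (a ·_) (sym (assoc u b u)) ⟩
    a · (u · b · u)   ≡⟨ cong (a ·_) (rightRegular u b) ⟩
    a · (b · u)       ≡⟨ sym (assoc a b u) ⟩
    a · b · u         ∎)

  ·ʳ-inverseˡ : ∀ {u v} → v · u ≡ u → (p : ↓ u) → proj₁ p · v · u ≡ proj₁ p
  ·ʳ-inverseˡ {u} {v} vu≡u (a , a≤u) = begin
    a · v · u   ≡⟨ assoc a v u ⟩
    a · (v · u) ≡⟨ cong (a ·_) vu≡u ⟩
    a · u       ≡⟨ ≤⇒· a≤u ⟩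
    a           ∎

  ≅↓-absorbing : ∀ {u v} → v · u ≡ u → u · v ≡ v → u ≅↓ v
  ≅↓-absorbing {u} {v} vu≡u uv≡v = record
    { to        = λ p → ·ʳ↓ v (proj₁ p)
    ; to-cong   = λ _ _ → cong (_· v)
    ; bijective = (λ q → ·ʳ↓ u (proj₁ q)) , ·ʳ-inverseˡ uv≡v , ·ʳ-inverseˡ vu≡u
    ; hom       = λ p q → ·-distribʳ v (proj₁ p) (proj₁ q)
    }

  ·-swap-absorbs : ∀ x y → (y · x) · (x · y) ≡ x · y
  ·-swap-absorbs x y = begin
    (y · x) · (x · y) ≡⟨ assoc y x (x · y) ⟩
    y · (x · (x · y)) ≡⟨ cong (y ·_) (sym (assoc x x y)) ⟩
    y · (x · x · y)   ≡⟨ cong (λ t → y · (t · y)) (idem x) ⟩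
    y · (x · y)       ≡⟨ sym (assoc y x y) ⟩
    y · x · y         ≡⟨ rightRegular y x ⟩
    x · y             ∎

corollary2p7 : ∀ {c ℓ} (P : RightPosemigroup c ℓ) → let open RightPosemigroup P in
    ∀ x y → (x · y) ≅↓ (y · x)
corollary2p7 P x y = ≅↓-absorbing P (·-swap-absorbs P x y) (·-swap-absorbs P y x)
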